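{- Let $t$ be a term of the CBV calculus $\lambda_{\mathtt{v}}$. Then $t$ is $\lambda_{\mathtt{v}}$-meaningful if and only if its CBV embedding $t^{\mathtt{v}}$ is $\lambda_{!}$-meaningful.
   Context: The distant bang calculus $\lambda_{!}$ has terms $t,u,s ::= x \mid tu \mid \lambda x.t \mid !t \mid \mathrm{der}(t) \mid t[x\backslash u]$ (where $t[x\backslash u]$ is an explicit substitution). List contexts are $L ::= \square \mid L[x\backslash t]$; surface contexts are $S ::= \square \mid St \mid tS \mid \lambda x.S \mid \mathrm{der}(S) \mid S[x\backslash t] \mid t[x\backslash S]$ (no hole under $!$). The rewrite rules are $L\langle\lambda x.t\rangle u \mapsto L\langle t[x\backslash u]\rangle$, $t[x\backslash L\langle !u\rangle] \mapsto L\langle t\{x:=u\}\rangle$, and $\mathrm{der}(L\langle !t\rangle) \mapsto L\langle t\rangle$; surface reduction $\to_S$ is their closure under surface contexts, and $\to_S^*$ its reflexive-transitive closure. A term $t$ is $\lambda_{!}$-meaningful if there are a testing context $T ::= \square \mid Ts \mid (\lambda x.T)s$ and a term $u$ such that $T\langle t\rangle \to_S^* !u$. The CBV calculus $\lambda_{\mathtt{v}}$ has terms $t,u ::= v \mid tu \mid t[x\backslash u]$ with values $v ::= x \mid \lambda x.t$, list contexts $L ::= \square \mid L[x\backslash t]$ and CBV surface contexts $V ::= \square \mid Vt \mid tV \mid V[x\backslash t] \mid t[x\backslash V]$; its surface reduction $\to_{\mathtt{v}}$ is the closure under CBV surface contexts of the rules $L\langle\lambda x.t\rangle u \mapsto L\langle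 t[x\backslash u]\rangle$ and $t[x\backslash L\langle v\rangle]\mapsto L\langle t\{x:=v\}\rangle$ ($v$ a value). A term $t$ is $\lambda_{\mathtt{v}}$-meaningful if there are a testing context $T ::= \square \mid Tu \mid (\lambda x.T)u$ and a value $v$ such that $T\langle t\rangle \to_{\mathtt{v}}^* v$. The CBV embedding into $\lambda_{!}$ is defined by $x^{\mathtt{v}} = !x$, $(\lambda x.t)^{\mathtt{v}} = !\lambda x.t^{\mathtt{v}}$, $(t[x\backslash u])^{\mathtt{v}} = t^{\mathtt{v}}[x\backslash u^{\mathtt{v}}]$, and $(tu)^{\mathtt{v}} = L\langle s\rangle\, u^{\mathtt{v}}$ if $t^{\mathtt{v}} = L\langle !s\rangle$ for some list context $L$, and $(tu)^{\mathtt{v}} = \mathrm{der}(t^{\mathtt{v}})\, u^{\mathtt{v}}$ otherwise. -}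

module Defs where

open import Data.Nat using (ℕ; zero; suc)
open import Data.Fin using (Fin; zero; suc)
open import Data.Maybe using (Maybe; just; nothing)
open import Data.Product using (Σ; ∃; _×_; _,_)
open import Relation.Binary.PropositionalEquality using (_≡_)
open import Relation.Binary.Construct.Closure.ReflexiveTransitive using (Star)
open import Function.Definitions using (Injective)

-- Well-scoped de Bruijn syntax: a term of type Tm n has its free variables among Fin n.
-- Index 0 is the most recently bound variable.

Ren : ℕ → ℕ → Set
Ren n m = Fin n → Fin m

liftR : ∀ {n m} → Ren n m → Ren (suc n) (suc m)
liftR ρ zero    = zero
liftR ρ (suc i) = suc (ρ i)

-- The distant bang calculus λ!

data Tm (n : ℕ) : Set where
  var  : Fin n → Tm n
  app  : Tm n → Tm n → Tm n
  lam  : Tm (suc n) → Tm n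
  bang : Tm n → Tm n
  der  : Tm n → Tm n
  es   : Tm (suc n) → Tm n → Tm n     -- t[x\u] (x is index 0 in t)

ren : ∀ {n m} → Ren n m → Tm n → Tm m
ren ρ (var i)   = var (ρ i)
ren ρ (app t u) = app (ren ρ t) (ren ρ u)
ren ρ (lam t)   = lam (ren (liftR ρ) t)
ren ρ (bang t)  = bang (ren ρ t)
ren ρ (der t)   = der (ren ρ t)
ren ρ (es t u)  = es (ren (liftR ρ) t) (ren ρ u)

Sub : ℕ → ℕ → Set
Sub n m = Fin n → Tm m

liftS : ∀ {n m} → Sub n m → Sub (suc n) (suc m)
liftS σ zero    = var zero
liftS σ (suc i) = ren suc (σ i)

sub : ∀ {n m} → Sub n m → Tm n → Tm m
sub σ (var i)   = σ i
sub σ (app t u) = app (sub σ t) (sub σ u)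
sub σ (lam t)   = lam (sub (liftS σ) t)
sub σ (bang t)  = bang (sub σ t)
sub σ (der t)   = der (sub σ t)
sub σ (es t u)  = es (sub (liftS σ) t) (sub σ u)

single : ∀ {n} → Tm n → Sub (suc n) n
single u zero    = u
single u (suc i) = var i

_[0:=_] : ∀ {n} → Tm (suc n) → Tm n → Tm n
t [0:= u ] = sub (single u) t

-- List contexts  L ::= □ | L[x\t].
-- LCtx n m : the context lives in scope n, its hole in scope m.
data LCtx (n : ℕ) : ℕ → Set where
  hole : LCtx n n
  esL  : ∀ {m} → LCtx (suc n) m → Tm n → LCtx n m

plugL : ∀ {n m} → LCtx n m → Tm m → Tm n
plugL hole      t = t
plugL (esL L s) t = es (plugL L t) s

wkL : ∀ {n m} → LCtx n m → Ren n m
wkL hole      = λ i → i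
wkL (esL L s) = λ i → wkL L (suc i)

data Root! {n : ℕ} : Tm n → Tm n → Set where
  dB  : ∀ {m} (L : LCtx n m) (t : Tm (suc m)) (u : Tm n) →
        Root! (app (plugL L (lam t)) u) (plugL L (es t (ren (wkL L) u)))
  s!  : ∀ {m} (L : LCtx n m) (t : Tm (suc n)) (u : Tm m) →
        Root! (es t (plugL L (bang u))) (plugL L (ren (liftR (wkL L)) t [0:= u ]))
  d!  : ∀ {m} (L : LCtx n m) (t : Tm m) →
        Root! (der (plugL L (bang t))) (plugL L t)

-- Surface reduction →S : closure under surface contexts (no hole under !)
data _→S_ : ∀ {n} → Tm n → Tm n → Set where
  root  : ∀ {n} {t t' : Tm n} → Root! t t' → t →S t'
  appL  : ∀ {n} {t t' : Tm n} (s : Tm n) → t →S t' → app t s →S app t' s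
  appR  : ∀ {n} {t t' : Tm n} (s : Tm n) → t →S t' → app s t →S app s t'
  lamC  : ∀ {n} {t t' : Tm (suc n)} → t →S t' → lam t →S lam t'
  derC  : ∀ {n} {t t' : Tm n} → t →S t' → der t →S der t'
  esLC  : ∀ {n} {t t' : Tm (suc n)} (s : Tm n) → t →S t' → es t s →S es t' s
  esRC  : ∀ {n} {t t' : Tm n} (s : Tm (suc n)) → t →S t' → es s t →S es s t'

_→S*_ : ∀ {n} → Tm n → Tm n → Set
_→S*_ {n} = Star (_→S_ {n})

data TCtx (n : ℕ) : ℕ → Set where
  hole : TCtx n n
  appT : ∀ {m} → TCtx n m → Tm n → TCtx n m
  redT : ∀ {m} → TCtx (suc n) m → Tm n → TCtx n m

plugT : ∀ {n m} → TCtx n m → Tm m → Tm n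
plugT hole       t = t
plugT (appT T s) t = app (plugT T t) s
plugT (redT T s) t = app (lam (plugT T t)) s

-- Plugging may capture free variables of t (as in the named presentation):
-- this is modelled by an injective renaming ρ of the free variables of t into the
-- hole scope of T (each free variable is either captured by a binder of T or
-- remains free).
Meaningful! : ∀ {n} → Tm n → Set
Meaningful! {n} t =
  Σ ℕ λ m → Σ ℕ λ k → Σ (TCtx m k) λ T → Σ (Ren n k) λ ρ →
    Injective _≡_ _≡_ ρ × Σ (Tm m) λ u → plugT T (ren ρ t) →S* bang u

-- The CBV calculus λv

data TmV (n : ℕ) : Set where
  var : Fin n → TmV n
  lam : TmV (suc n) → TmV n
  app : TmV n → TmV n → TmV n
  es  : TmV (suc n) → TmV n → TmV n

data IsValue {n : ℕ} : TmV n → Set where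
  var : (i : Fin n) → IsValue (var i)
  lam : (t : TmV (suc n)) → IsValue (lam t)

renV : ∀ {n m} → Ren n m → TmV n → TmV m
renV ρ (var i)   = var (ρ i)
renV ρ (lam t)   = lam (renV (liftR ρ) t)
renV ρ (app t u) = app (renV ρ t) (renV ρ u)
renV ρ (es t u)  = es (renV (liftR ρ) t) (renV ρ u)

liftSV : ∀ {n m} → (Fin n → TmV m) → Fin (suc n) → TmV (suc m)
liftSV σ zero    = var zero
liftSV σ (suc i) = renV suc (σ i)

subV : ∀ {n m} → (Fin n → TmV m) → TmV n → TmV m
subV σ (var i)   = σ i
subV σ (lam t)   = lam (subV (liftSV σ) t)
subV σ (app t u) = app (subV σ t) (subV σ u)
subV σ (es t u)  = es (subV (liftSV σ) t) (subV σ u)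

singleV : ∀ {n} → TmV n → Fin (suc n) → TmV n
singleV u zero    = u
singleV u (suc i) = var i

data LCtxV (n : ℕ) : ℕ → Set where
  hole : LCtxV n n
  esL  : ∀ {m} → LCtxV (suc n) m → TmV n → LCtxV n m

plugLV : ∀ {n m} → LCtxV n m → TmV m → TmV n
plugLV hole      t = t
plugLV (esL L s) t = es (plugLV L t) s

wkLV : ∀ {n m} → LCtxV n m → Ren n m
wkLV hole      = λ i → i
wkLV (esL L s) = λ i → wkLV L (suc i)

data RootV {n : ℕ} : TmV n → TmV n → Set where
  dB  : ∀ {m} (L : LCtxV n m) (t : TmV (suc m)) (u : TmV n) →
        RootV (app (plugLV L (lam t)) u) (plugLV L (es t (renV (wkLV L) u)))
  sv  : ∀ {m} (L : LCtxV n m) (t : TmV (suc n)) (v : TmV m) → IsValue v →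
        RootV (es t (plugLV L v)) (plugLV L (subV (singleV v) (renV (liftR (wkLV L)) t)))

data _→v_ : ∀ {n} → TmV n → TmV n → Set where
  root  : ∀ {n} {t t' : TmV n} → RootV t t' → t →v t'
  appL  : ∀ {n} {t t' : TmV n} (s : TmV n) → t →v t' → app t s →v app t' s
  appR  : ∀ {n} {t t' : TmV n} (s : TmV n) → t →v t' → app s t →v app s t'
  esLC  : ∀ {n} {t t' : TmV (suc n)} (s : TmV n) → t →v t' → es t s →v es t' s
  esRC  : ∀ {n} {t t' : TmV n} (s : TmV (suc n)) → t →v t' → es s t →v es s t'

_→v*_ : ∀ {n} → TmV n → TmV n → Set
_→v*_ {n} = Star (_→v_ {n})

data TCtxV (n : ℕ) : ℕ → Set where
  hole : TCtxV n n
  appT : ∀ {m} → TCtxV n m → TmV n → TCtxV n m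
  redT : ∀ {m} → TCtxV (suc n) m → TmV n → TCtxV n m

plugTV : ∀ {n m} → TCtxV n m → TmV m → TmV n
plugTV hole       t = t
plugTV (appT T s) t = app (plugTV T t) s
plugTV (redT T s) t = app (lam (plugTV T t)) s

MeaningfulV : ∀ {n} → TmV n → Set
MeaningfulV {n} t =
  Σ ℕ λ m → Σ ℕ λ k → Σ (TCtxV m k) λ T → Σ (Ren n k) λ ρ →
    Injective _≡_ _≡_ ρ × Σ (TmV m) λ v → IsValue v × (plugTV T (renV ρ t) →v* v)

-- decomposition t = L⟨!s⟩ (unique when it exists)
splitBang : ∀ {n} → Tm n → Maybe (Σ ℕ λ m → LCtx n m × Tm m)
splitBang (bang s) = just (_ , hole , s)
splitBang (es t u) with splitBang t
... | just (m , L , s) = just (m , esL L u , s)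
... | nothing          = nothing
splitBang _ = nothing

embApp : ∀ {n} → Tm n → Tm n → Tm n
embApp t u with splitBang t
... | just (m , L , s) = app (plugL L s) u
... | nothing          = app (der t) u

_ᵛ : ∀ {n} → TmV n → Tm n
var x ᵛ   = bang (var x)
lam t ᵛ   = bang (lam (t ᵛ))
es t u ᵛ  = es (t ᵛ) (u ᵛ)
app t u ᵛ = embApp (t ᵛ) (u ᵛ)

-- Both notions of meaningfulness coincide with surface normalisability in λv.  Surface
-- reduction of λ! has the diamond property, so a term reducing to some !u is strongly
-- normalising, and then so is every term in a surface position inside it.  Each surface step
-- of λv is simulated by a non-empty λ!-reduction of the embedding, so strong normalisation
-- transfers back to λv.  Conversely, a surface normal form of λv evaluates to a value once a
-- testing context binds each of its free variables to an eater, a closed value swallowing any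
-- value argument, and the embedding carries this evaluation over to λ!.

module Submission where

open import Defs
open import Data.Nat using (ℕ; zero; suc)
open import Data.Fin using (Fin; zero; suc)
open import Data.Bool using (Bool; true; false)
open import Data.Maybe using (just; nothing)
open import Data.Product using (Σ; ∃; _×_; _,_)
open import Data.Sum using (_⊎_; inj₁; inj₂)
open import Data.Empty using (⊥-elim)
open import Function using (_∘_; id; flip)
open import Induction.WellFounded using (Acc; acc)
open import Relation.Nullary using (¬_)
open import Relation.Binary.Core using (_Preserves_⟶_)
open import Relation.Binary.PropositionalEquality
open import Relation.Binary.Construct.Closure.ReflexiveTransitive using (Star; ε; _◅_; _◅◅_; gmap)

liftR-ext : ∀ {n m} {ρ ρ' : Ren n m} → ρ ≗ ρ' → liftR ρ ≗ liftR ρ'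
liftR-ext e zero    = refl
liftR-ext e (suc i) = cong suc (e i)

liftR-id : ∀ {n} → liftR {n} id ≗ id
liftR-id zero    = refl
liftR-id (suc i) = refl

ren-ext : ∀ {n m} {ρ ρ' : Ren n m} → ρ ≗ ρ' → ren ρ ≗ ren ρ'
ren-ext e (var i)   = cong var (e i)
ren-ext e (app t u) = cong₂ app (ren-ext e t) (ren-ext e u)
ren-ext e (lam t)   = cong lam (ren-ext (liftR-ext e) t)
ren-ext e (bang t)  = cong bang (ren-ext e t)
ren-ext e (der t)   = cong der (ren-ext e t)
ren-ext e (es t u)  = cong₂ es (ren-ext (liftR-ext e) t) (ren-ext e u)

liftS-ext : ∀ {n m} {σ σ' : Sub n m} → σ ≗ σ' → liftS σ ≗ liftS σ'
liftS-ext e zero    = refl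
liftS-ext e (suc i) = cong (ren suc) (e i)

sub-ext : ∀ {n m} {σ σ' : Sub n m} → σ ≗ σ' → sub σ ≗ sub σ'
sub-ext e (var i)   = e i
sub-ext e (app t u) = cong₂ app (sub-ext e t) (sub-ext e u)
sub-ext e (lam t)   = cong lam (sub-ext (liftS-ext e) t)
sub-ext e (bang t)  = cong bang (sub-ext e t)
sub-ext e (der t)   = cong der (sub-ext e t)
sub-ext e (es t u)  = cong₂ es (sub-ext (liftS-ext e) t) (sub-ext e u)

liftS-var : ∀ {n m} (ρ : Ren n m) → var ∘ liftR ρ ≗ liftS (var ∘ ρ)
liftS-var ρ zero    = refl
liftS-var ρ (suc i) = refl

ren-as-sub : ∀ {n m} (ρ : Ren n m) → ren ρ ≗ sub (var ∘ ρ)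
ren-as-sub ρ (var i)   = refl
ren-as-sub ρ (app t u) = cong₂ app (ren-as-sub ρ t) (ren-as-sub ρ u)
ren-as-sub ρ (lam t)   = cong lam (trans (ren-as-sub (liftR ρ) t) (sub-ext (liftS-var ρ) t))
ren-as-sub ρ (bang t)  = cong bang (ren-as-sub ρ t)
ren-as-sub ρ (der t)   = cong der (ren-as-sub ρ t)
ren-as-sub ρ (es t u)  =
  cong₂ es (trans (ren-as-sub (liftR ρ) t) (sub-ext (liftS-var ρ) t)) (ren-as-sub ρ u)

liftS-id : ∀ {n} {σ : Sub n n} → σ ≗ var → liftS σ ≗ var
liftS-id e zero    = refl
liftS-id e (suc i) = cong (ren suc) (e i)

sub-id : ∀ {n} {σ : Sub n n} → σ ≗ var → sub σ ≗ id
sub-id e (var i)   = e i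
sub-id e (app t u) = cong₂ app (sub-id e t) (sub-id e u)
sub-id e (lam t)   = cong lam (sub-id (liftS-id e) t)
sub-id e (bang t)  = cong bang (sub-id e t)
sub-id e (der t)   = cong der (sub-id e t)
sub-id e (es t u)  = cong₂ es (sub-id (liftS-id e) t) (sub-id e u)

ren-id : ∀ {n} {ρ : Ren n n} → ρ ≗ id → ren ρ ≗ id
ren-id {ρ = ρ} e t = trans (ren-as-sub ρ t) (sub-id (cong var ∘ e) t)

liftS-liftR : ∀ {n m k} (σ : Sub m k) (ρ : Ren n m) → liftS σ ∘ liftR ρ ≗ liftS (σ ∘ ρ)
liftS-liftR σ ρ zero    = refl
liftS-liftR σ ρ (suc i) = refl

sub-ren : ∀ {n m k} (σ : Sub m k) (ρ : Ren n m) → sub σ ∘ ren ρ ≗ sub (σ ∘ ρ)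
sub-ren σ ρ (var i)   = refl
sub-ren σ ρ (app t u) = cong₂ app (sub-ren σ ρ t) (sub-ren σ ρ u)
sub-ren σ ρ (lam t)   = cong lam (trans (sub-ren _ _ t) (sub-ext (liftS-liftR σ ρ) t))
sub-ren σ ρ (bang t)  = cong bang (sub-ren σ ρ t)
sub-ren σ ρ (der t)   = cong der (sub-ren σ ρ t)
sub-ren σ ρ (es t u)  = cong₂ es (trans (sub-ren _ _ t) (sub-ext (liftS-liftR σ ρ) t)) (sub-ren σ ρ u)

ren-ren : ∀ {n m k} (ρ' : Ren m k) (ρ : Ren n m) → ren ρ' ∘ ren ρ ≗ ren (ρ' ∘ ρ)
ren-ren ρ' ρ t = begin
  ren ρ' (ren ρ t)          ≡⟨ ren-as-sub ρ' (ren ρ t) ⟩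
  sub (var ∘ ρ') (ren ρ t)  ≡⟨ sub-ren (var ∘ ρ') ρ t ⟩
  sub (var ∘ ρ' ∘ ρ) t      ≡⟨ ren-as-sub (ρ' ∘ ρ) t ⟨
  ren (ρ' ∘ ρ) t            ∎
  where open ≡-Reasoning

ren-suc-liftR : ∀ {n m} (ρ : Ren n m) → ren (liftR ρ) ∘ ren suc ≗ ren suc ∘ ren ρ
ren-suc-liftR ρ t = trans (ren-ren (liftR ρ) suc t) (sym (ren-ren suc ρ t))

liftR-liftS : ∀ {n m k} (ρ : Ren m k) (σ : Sub n m) → ren (liftR ρ) ∘ liftS σ ≗ liftS (ren ρ ∘ σ)
liftR-liftS ρ σ zero    = refl
liftR-liftS ρ σ (suc i) = ren-suc-liftR ρ (σ i)

ren-sub : ∀ {n m k} (ρ : Ren m k) (σ : Sub n m) → ren ρ ∘ sub σ ≗ sub (ren ρ ∘ σ)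
ren-sub ρ σ (var i)   = refl
ren-sub ρ σ (app t u) = cong₂ app (ren-sub ρ σ t) (ren-sub ρ σ u)
ren-sub ρ σ (lam t)   = cong lam (trans (ren-sub _ _ t) (sub-ext (liftR-liftS ρ σ) t))
ren-sub ρ σ (bang t)  = cong bang (ren-sub ρ σ t)
ren-sub ρ σ (der t)   = cong der (ren-sub ρ σ t)
ren-sub ρ σ (es t u)  = cong₂ es (trans (ren-sub _ _ t) (sub-ext (liftR-liftS ρ σ) t)) (ren-sub ρ σ u)

sub-suc-liftS : ∀ {n m} (σ : Sub n m) → sub (liftS σ) ∘ ren suc ≗ ren suc ∘ sub σ
sub-suc-liftS σ t = trans (sub-ren (liftS σ) suc t) (sym (ren-sub suc σ t))

liftS-liftS : ∀ {n m k} (σ : Sub m k) (τ : Sub n m) → sub (liftS σ) ∘ liftS τ ≗ liftS (sub σ ∘ τ)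
liftS-liftS σ τ zero    = refl
liftS-liftS σ τ (suc i) = sub-suc-liftS σ (τ i)

sub-sub : ∀ {n m k} (σ : Sub m k) (τ : Sub n m) → sub σ ∘ sub τ ≗ sub (sub σ ∘ τ)
sub-sub σ τ (var i)   = refl
sub-sub σ τ (app t u) = cong₂ app (sub-sub σ τ t) (sub-sub σ τ u)
sub-sub σ τ (lam t)   = cong lam (trans (sub-sub _ _ t) (sub-ext (liftS-liftS σ τ) t))
sub-sub σ τ (bang t)  = cong bang (sub-sub σ τ t)
sub-sub σ τ (der t)   = cong der (sub-sub σ τ t)
sub-sub σ τ (es t u)  = cong₂ es (trans (sub-sub _ _ t) (sub-ext (liftS-liftS σ τ) t)) (sub-sub σ τ u)

SubV : ℕ → ℕ → Set
SubV n m = Fin n → TmV m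

liftSV-ext : ∀ {n m} {σ σ' : SubV n m} → σ ≗ σ' → liftSV σ ≗ liftSV σ'
liftSV-ext e zero    = refl
liftSV-ext e (suc i) = cong (renV suc) (e i)

subV-ext : ∀ {n m} {σ σ' : SubV n m} → σ ≗ σ' → subV σ ≗ subV σ'
subV-ext e (var i)   = e i
subV-ext e (lam t)   = cong lam (subV-ext (liftSV-ext e) t)
subV-ext e (app t u) = cong₂ app (subV-ext e t) (subV-ext e u)
subV-ext e (es t u)  = cong₂ es (subV-ext (liftSV-ext e) t) (subV-ext e u)

liftSV-var : ∀ {n m} (ρ : Ren n m) → var ∘ liftR ρ ≗ liftSV (var ∘ ρ)
liftSV-var ρ zero    = refl
liftSV-var ρ (suc i) = refl

renV-as-subV : ∀ {n m} (ρ : Ren n m) → renV ρ ≗ subV (var ∘ ρ)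
renV-as-subV ρ (var i)   = refl
renV-as-subV ρ (lam t)   = cong lam (trans (renV-as-subV _ t) (subV-ext (liftSV-var ρ) t))
renV-as-subV ρ (app t u) = cong₂ app (renV-as-subV ρ t) (renV-as-subV ρ u)
renV-as-subV ρ (es t u)  =
  cong₂ es (trans (renV-as-subV _ t) (subV-ext (liftSV-var ρ) t)) (renV-as-subV ρ u)

liftSV-id : ∀ {n} {σ : SubV n n} → σ ≗ var → liftSV σ ≗ var
liftSV-id e zero    = refl
liftSV-id e (suc i) = cong (renV suc) (e i)

subV-id : ∀ {n} {σ : SubV n n} → σ ≗ var → subV σ ≗ id
subV-id e (var i)   = e i
subV-id e (lam t)   = cong lam (subV-id (liftSV-id e) t)
subV-id e (app t u) = cong₂ app (subV-id e t) (subV-id e u)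
subV-id e (es t u)  = cong₂ es (subV-id (liftSV-id e) t) (subV-id e u)

renV-id : ∀ {n} {ρ : Ren n n} → ρ ≗ id → renV ρ ≗ id
renV-id {ρ = ρ} e t = trans (renV-as-subV ρ t) (subV-id (cong var ∘ e) t)

liftSV-liftR : ∀ {n m k} (σ : SubV m k) (ρ : Ren n m) → liftSV σ ∘ liftR ρ ≗ liftSV (σ ∘ ρ)
liftSV-liftR σ ρ zero    = refl
liftSV-liftR σ ρ (suc i) = refl

subV-renV : ∀ {n m k} (σ : SubV m k) (ρ : Ren n m) → subV σ ∘ renV ρ ≗ subV (σ ∘ ρ)
subV-renV σ ρ (var i)   = refl
subV-renV σ ρ (lam t)   = cong lam (trans (subV-renV _ _ t) (subV-ext (liftSV-liftR σ ρ) t))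
subV-renV σ ρ (app t u) = cong₂ app (subV-renV σ ρ t) (subV-renV σ ρ u)
subV-renV σ ρ (es t u)  =
  cong₂ es (trans (subV-renV _ _ t) (subV-ext (liftSV-liftR σ ρ) t)) (subV-renV σ ρ u)

renV-renV : ∀ {n m k} (ρ' : Ren m k) (ρ : Ren n m) → renV ρ' ∘ renV ρ ≗ renV (ρ' ∘ ρ)
renV-renV ρ' ρ t = begin
  renV ρ' (renV ρ t)          ≡⟨ renV-as-subV ρ' (renV ρ t) ⟩
  subV (var ∘ ρ') (renV ρ t)  ≡⟨ subV-renV (var ∘ ρ') ρ t ⟩
  subV (var ∘ ρ' ∘ ρ) t       ≡⟨ renV-as-subV (ρ' ∘ ρ) t ⟨
  renV (ρ' ∘ ρ) t             ∎
  where open ≡-Reasoning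

liftR-liftSV : ∀ {n m k} (ρ : Ren m k) (σ : SubV n m) → renV (liftR ρ) ∘ liftSV σ ≗ liftSV (renV ρ ∘ σ)
liftR-liftSV ρ σ zero    = refl
liftR-liftSV ρ σ (suc i) = trans (renV-renV (liftR ρ) suc (σ i)) (sym (renV-renV suc ρ (σ i)))

renV-subV : ∀ {n m k} (ρ : Ren m k) (σ : SubV n m) → renV ρ ∘ subV σ ≗ subV (renV ρ ∘ σ)
renV-subV ρ σ (var i)   = refl
renV-subV ρ σ (lam t)   = cong lam (trans (renV-subV _ _ t) (subV-ext (liftR-liftSV ρ σ) t))
renV-subV ρ σ (app t u) = cong₂ app (renV-subV ρ σ t) (renV-subV ρ σ u)
renV-subV ρ σ (es t u)  =
  cong₂ es (trans (renV-subV _ _ t) (subV-ext (liftR-liftSV ρ σ) t)) (renV-subV ρ σ u)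

liftSV-liftSV : ∀ {n m k} (σ : SubV m k) (τ : SubV n m) → subV (liftSV σ) ∘ liftSV τ ≗ liftSV (subV σ ∘ τ)
liftSV-liftSV σ τ zero    = refl
liftSV-liftSV σ τ (suc i) = trans (subV-renV (liftSV σ) suc (τ i)) (sym (renV-subV suc σ (τ i)))

subV-subV : ∀ {n m k} (σ : SubV m k) (τ : SubV n m) → subV σ ∘ subV τ ≗ subV (subV σ ∘ τ)
subV-subV σ τ (var i)   = refl
subV-subV σ τ (lam t)   = cong lam (trans (subV-subV _ _ t) (subV-ext (liftSV-liftSV σ τ) t))
subV-subV σ τ (app t u) = cong₂ app (subV-subV σ τ t) (subV-subV σ τ u)
subV-subV σ τ (es t u)  =
  cong₂ es (trans (subV-subV _ _ t) (subV-ext (liftSV-liftSV σ τ) t)) (subV-subV σ τ u)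

-- Surface reduction of λ! and its diamond property

data LLam {n : ℕ} : Tm n → Set where
  atLam   : (t : Tm (suc n)) → LLam (lam t)
  underES : {X : Tm (suc n)} → LLam X → (s : Tm n) → LLam (es X s)

data LBang {n : ℕ} : Tm n → Set where
  atBang  : (u : Tm n) → LBang (bang u)
  underES : {X : Tm (suc n)} → LBang X → (s : Tm n) → LBang (es X s)

LLam-unique : ∀ {n} {X : Tm n} (p p' : LLam X) → p ≡ p'
LLam-unique (atLam t)     (atLam .t)      = refl
LLam-unique (underES p s) (underES p' .s) = cong (λ z → underES z s) (LLam-unique p p')

LBang-unique : ∀ {n} {X : Tm n} (q q' : LBang X) → q ≡ q'
LBang-unique (atBang u)    (atBang .u)     = refl
LBang-unique (underES q s) (underES q' .s) = cong (λ z → underES z s) (LBang-unique q q')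

dB-reduct : ∀ {n} {X : Tm n} → LLam X → Tm n → Tm n
dB-reduct (atLam t)     u = es t u
dB-reduct (underES p s) u = es (dB-reduct p (ren suc u)) s

s!-reduct : ∀ {n} {X : Tm n} → Tm (suc n) → LBang X → Tm n
s!-reduct t (atBang u)    = t [0:= u ]
s!-reduct t (underES q s) = es (s!-reduct (ren (liftR suc) t) q) s

d!-reduct : ∀ {n} {X : Tm n} → LBang X → Tm n
d!-reduct (atBang u)    = u
d!-reduct (underES q s) = es (d!-reduct q) s

-- →S, with the list context of each redex given by an LLam/LBang proof instead of an LCtx.
infix 4 _⇒_
data _⇒_ : ∀ {n} → Tm n → Tm n → Set where
  dB   : ∀ {n} {X : Tm n} (p : LLam X) (u : Tm n) → app X u ⇒ dB-reduct p u
  s!   : ∀ {n} {X : Tm n} (t : Tm (suc n)) (q : LBang X) → es t X ⇒ s!-reduct t q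
  d!   : ∀ {n} {X : Tm n} (q : LBang X) → der X ⇒ d!-reduct q
  appL : ∀ {n} {t t' : Tm n} (s : Tm n) → t ⇒ t' → app t s ⇒ app t' s
  appR : ∀ {n} {t t' : Tm n} (s : Tm n) → t ⇒ t' → app s t ⇒ app s t'
  lamC : ∀ {n} {t t' : Tm (suc n)} → t ⇒ t' → lam t ⇒ lam t'
  derC : ∀ {n} {t t' : Tm n} → t ⇒ t' → der t ⇒ der t'
  esLC : ∀ {n} {t t' : Tm (suc n)} (s : Tm n) → t ⇒ t' → es t s ⇒ es t' s
  esRC : ∀ {n} {t t' : Tm n} (s : Tm (suc n)) → t ⇒ t' → es s t ⇒ es s t'

infix 4 _⇒*_
_⇒*_ : ∀ {n} → Tm n → Tm n → Set
_⇒*_ {n} = Star (_⇒_ {n})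

plugL-LLam : ∀ {n m} (L : LCtx n m) (t : Tm (suc m)) →
             Σ (LLam (plugL L (lam t))) λ p → ∀ u → dB-reduct p u ≡ plugL L (es t (ren (wkL L) u))
plugL-LLam hole      t = atLam t , λ u → cong (es t) (sym (ren-id (λ _ → refl) u))
plugL-LLam (esL L s) t with plugL-LLam L t
... | p , e = underES p s , λ u →
  cong (λ z → es z s) (trans (e (ren suc u)) (cong (λ z → plugL L (es t z)) (ren-ren (wkL L) suc u)))

plugL-LBang : ∀ {n m} (L : LCtx n m) (u : Tm m) →
              Σ (LBang (plugL L (bang u))) λ q →
                (∀ t → s!-reduct t q ≡ plugL L (ren (liftR (wkL L)) t [0:= u ])) × d!-reduct q ≡ plugL L u
plugL-LBang hole      u = atBang u , (λ t → cong (_[0:= u ]) (sym (ren-id liftR-id t))) , refl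
plugL-LBang (esL L s) u with plugL-LBang L u
... | q , e , d = underES q s ,
  (λ t → cong (λ z → es z s) (trans (e (ren (liftR suc) t))
           (cong (λ z → plugL L (z [0:= u ])) (trans (ren-ren (liftR (wkL L)) (liftR suc) t) (ren-ext lift t))))) ,
  cong (λ z → es z s) d
  where
  lift : liftR (wkL L) ∘ liftR suc ≗ liftR (wkL L ∘ suc)
  lift zero    = refl
  lift (suc i) = refl

LLam-plugL : ∀ {n} {X : Tm n} → LLam X → ∃ λ m → Σ (LCtx n m) λ L → Σ (Tm (suc m)) λ t → X ≡ plugL L (lam t)
LLam-plugL (atLam t) = _ , hole , t , refl
LLam-plugL (underES p s) with LLam-plugL p
... | m , L , t , refl = m , esL L s , t , refl

LBang-plugL : ∀ {n} {X : Tm n} → LBang X → ∃ λ m → Σ (LCtx n m) λ L → Σ (Tm m) λ u → X ≡ plugL L (bang u)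
LBang-plugL (atBang u) = _ , hole , u , refl
LBang-plugL (underES q s) with LBang-plugL q
... | m , L , u , refl = m , esL L s , u , refl

→S-to-⇒ : ∀ {n} {a b : Tm n} → a →S b → a ⇒ b
→S-to-⇒ (root (dB L t u)) with plugL-LLam L t
... | p , e = subst (_ ⇒_) (e u) (dB p u)
→S-to-⇒ (root (s! L t u)) with plugL-LBang L u
... | q , e , _ = subst (_ ⇒_) (e t) (s! t q)
→S-to-⇒ (root (d! L t)) with plugL-LBang L t
... | q , _ , d = subst (_ ⇒_) d (d! q)
→S-to-⇒ (appL s r) = appL s (→S-to-⇒ r)
→S-to-⇒ (appR s r) = appR s (→S-to-⇒ r)
→S-to-⇒ (lamC r)   = lamC (→S-to-⇒ r)
→S-to-⇒ (derC r)   = derC (→S-to-⇒ r)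
→S-to-⇒ (esLC s r) = esLC s (→S-to-⇒ r)
→S-to-⇒ (esRC s r) = esRC s (→S-to-⇒ r)

⇒-to-→S : ∀ {n} {a b : Tm n} → a ⇒ b → a →S b
⇒-to-→S (dB p u) with LLam-plugL p
... | _ , L , t , refl with plugL-LLam L t
... | p' , e = subst (_ →S_) (trans (sym (e u)) (cong (λ z → dB-reduct z u) (LLam-unique p' p))) (root (dB L t u))
⇒-to-→S (s! t q) with LBang-plugL q
... | _ , L , u , refl with plugL-LBang L u
... | q' , e , _ = subst (_ →S_) (trans (sym (e t)) (cong (s!-reduct t) (LBang-unique q' q))) (root (s! L t u))
⇒-to-→S (d! q) with LBang-plugL q
... | _ , L , u , refl with plugL-LBang L u
... | q' , _ , d = subst (_ →S_) (trans (sym d) (cong d!-reduct (LBang-unique q' q))) (root (d! L u))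
⇒-to-→S (appL s r) = appL s (⇒-to-→S r)
⇒-to-→S (appR s r) = appR s (⇒-to-→S r)
⇒-to-→S (lamC r)   = lamC (⇒-to-→S r)
⇒-to-→S (derC r)   = derC (⇒-to-→S r)
⇒-to-→S (esLC s r) = esLC s (⇒-to-→S r)
⇒-to-→S (esRC s r) = esRC s (⇒-to-→S r)

ren-LLam : ∀ {n m} (ρ : Ren n m) {X : Tm n} → LLam X → LLam (ren ρ X)
ren-LLam ρ (atLam t)     = atLam (ren (liftR ρ) t)
ren-LLam ρ (underES p s) = underES (ren-LLam (liftR ρ) p) (ren ρ s)

sub-LLam : ∀ {n m} (σ : Sub n m) {X : Tm n} → LLam X → LLam (sub σ X)
sub-LLam σ (atLam t)     = atLam (sub (liftS σ) t)
sub-LLam σ (underES p s) = underES (sub-LLam (liftS σ) p) (sub σ s)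

ren-LBang : ∀ {n m} (ρ : Ren n m) {X : Tm n} → LBang X → LBang (ren ρ X)
ren-LBang ρ (atBang u)    = atBang (ren ρ u)
ren-LBang ρ (underES q s) = underES (ren-LBang (liftR ρ) q) (ren ρ s)

sub-LBang : ∀ {n m} (σ : Sub n m) {X : Tm n} → LBang X → LBang (sub σ X)
sub-LBang σ (atBang u)    = atBang (sub σ u)
sub-LBang σ (underES q s) = underES (sub-LBang (liftS σ) q) (sub σ s)

ren-dB-reduct : ∀ {n m} (ρ : Ren n m) {X : Tm n} (p : LLam X) (u : Tm n) →
                ren ρ (dB-reduct p u) ≡ dB-reduct (ren-LLam ρ p) (ren ρ u)
ren-dB-reduct ρ (atLam t)     u = refl
ren-dB-reduct ρ (underES p s) u = cong (λ z → es z (ren ρ s))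
  (trans (ren-dB-reduct (liftR ρ) p (ren suc u)) (cong (dB-reduct (ren-LLam (liftR ρ) p)) (ren-suc-liftR ρ u)))

sub-dB-reduct : ∀ {n m} (σ : Sub n m) {X : Tm n} (p : LLam X) (u : Tm n) →
                sub σ (dB-reduct p u) ≡ dB-reduct (sub-LLam σ p) (sub σ u)
sub-dB-reduct σ (atLam t)     u = refl
sub-dB-reduct σ (underES p s) u = cong (λ z → es z (sub σ s))
  (trans (sub-dB-reduct (liftS σ) p (ren suc u)) (cong (dB-reduct (sub-LLam (liftS σ) p)) (sub-suc-liftS σ u)))

ren-d!-reduct : ∀ {n m} (ρ : Ren n m) {X : Tm n} (q : LBang X) → ren ρ (d!-reduct q) ≡ d!-reduct (ren-LBang ρ q)
ren-d!-reduct ρ (atBang u)    = refl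
ren-d!-reduct ρ (underES q s) = cong (λ z → es z (ren ρ s)) (ren-d!-reduct (liftR ρ) q)

sub-d!-reduct : ∀ {n m} (σ : Sub n m) {X : Tm n} (q : LBang X) → sub σ (d!-reduct q) ≡ d!-reduct (sub-LBang σ q)
sub-d!-reduct σ (atBang u)    = refl
sub-d!-reduct σ (underES q s) = cong (λ z → es z (sub σ s)) (sub-d!-reduct (liftS σ) q)

ren-[0:=] : ∀ {n m} (ρ : Ren n m) (t : Tm (suc n)) (u : Tm n) → ren ρ (t [0:= u ]) ≡ ren (liftR ρ) t [0:= ren ρ u ]
ren-[0:=] ρ t u = trans (ren-sub ρ (single u) t) (trans (sub-ext e t) (sym (sub-ren (single (ren ρ u)) (liftR ρ) t)))
  where
  e : ren ρ ∘ single u ≗ single (ren ρ u) ∘ liftR ρ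
  e zero    = refl
  e (suc i) = refl

sub-[0:=] : ∀ {n m} (σ : Sub n m) (t : Tm (suc n)) (u : Tm n) → sub σ (t [0:= u ]) ≡ sub (liftS σ) t [0:= sub σ u ]
sub-[0:=] σ t u = trans (sub-sub σ (single u) t) (trans (sub-ext e t) (sym (sub-sub (single (sub σ u)) (liftS σ) t)))
  where
  e : sub σ ∘ single u ≗ sub (single (sub σ u)) ∘ liftS σ
  e zero    = refl
  e (suc i) = sym (trans (sub-ren (single (sub σ u)) suc (σ i)) (sub-id (λ _ → refl) (σ i)))

liftR-liftR-suc : ∀ {n m} (ρ : Ren n m) → liftR (liftR ρ) ∘ liftR suc ≗ liftR suc ∘ liftR ρ
liftR-liftR-suc ρ zero    = refl
liftR-liftR-suc ρ (suc i) = refl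

ren-s!-reduct : ∀ {n m} (ρ : Ren n m) (t : Tm (suc n)) {X : Tm n} (q : LBang X) →
                ren ρ (s!-reduct t q) ≡ s!-reduct (ren (liftR ρ) t) (ren-LBang ρ q)
ren-s!-reduct ρ t (atBang u)    = ren-[0:=] ρ t u
ren-s!-reduct ρ t (underES q s) = cong (λ z → es z (ren ρ s))
  (trans (ren-s!-reduct (liftR ρ) (ren (liftR suc) t) q) (cong (λ z → s!-reduct z (ren-LBang (liftR ρ) q))
    (trans (ren-ren _ _ t) (trans (ren-ext (liftR-liftR-suc ρ) t) (sym (ren-ren _ _ t))))))

liftS-liftS-suc : ∀ {n m} (σ : Sub n m) → liftS (liftS σ) ∘ liftR suc ≗ ren (liftR suc) ∘ liftS σ
liftS-liftS-suc σ zero    = refl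
liftS-liftS-suc σ (suc i) = trans (ren-ren suc suc (σ i)) (sym (ren-ren (liftR suc) suc (σ i)))

sub-s!-reduct : ∀ {n m} (σ : Sub n m) (t : Tm (suc n)) {X : Tm n} (q : LBang X) →
                sub σ (s!-reduct t q) ≡ s!-reduct (sub (liftS σ) t) (sub-LBang σ q)
sub-s!-reduct σ t (atBang u)    = sub-[0:=] σ t u
sub-s!-reduct σ t (underES q s) = cong (λ z → es z (sub σ s))
  (trans (sub-s!-reduct (liftS σ) (ren (liftR suc) t) q) (cong (λ z → s!-reduct z (sub-LBang (liftS σ) q))
    (trans (sub-ren _ _ t) (trans (sub-ext (liftS-liftS-suc σ) t) (sym (ren-sub _ _ t))))))

⇒-sub : ∀ {n m} (σ : Sub n m) {t t' : Tm n} → t ⇒ t' → sub σ t ⇒ sub σ t'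
⇒-sub σ (dB p u)   = subst (_ ⇒_) (sym (sub-dB-reduct σ p u)) (dB (sub-LLam σ p) (sub σ u))
⇒-sub σ (s! t q)   = subst (_ ⇒_) (sym (sub-s!-reduct σ t q)) (s! (sub (liftS σ) t) (sub-LBang σ q))
⇒-sub σ (d! q)     = subst (_ ⇒_) (sym (sub-d!-reduct σ q)) (d! (sub-LBang σ q))
⇒-sub σ (appL s r) = appL _ (⇒-sub σ r)
⇒-sub σ (appR s r) = appR _ (⇒-sub σ r)
⇒-sub σ (lamC r)   = lamC (⇒-sub (liftS σ) r)
⇒-sub σ (derC r)   = derC (⇒-sub σ r)
⇒-sub σ (esLC s r) = esLC _ (⇒-sub (liftS σ) r)
⇒-sub σ (esRC s r) = esRC _ (⇒-sub σ r)

⇒-ren : ∀ {n m} (ρ : Ren n m) {t t' : Tm n} → t ⇒ t' → ren ρ t ⇒ ren ρ t'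
⇒-ren ρ {t} {t'} r = subst₂ _⇒_ (sym (ren-as-sub ρ t)) (sym (ren-as-sub ρ t')) (⇒-sub (var ∘ ρ) r)

LLam-s!-reduct : ∀ {n} {Y : Tm (suc n)} {s : Tm n} → LLam Y → (r : LBang s) → LLam (s!-reduct Y r)
LLam-s!-reduct p (atBang w)    = sub-LLam (single w) p
LLam-s!-reduct p (underES r a) = underES (LLam-s!-reduct (ren-LLam (liftR suc) p) r) a

LBang-s!-reduct : ∀ {n} {Y : Tm (suc n)} {s : Tm n} → LBang Y → (r : LBang s) → LBang (s!-reduct Y r)
LBang-s!-reduct q (atBang w)    = sub-LBang (single w) q
LBang-s!-reduct q (underES r a) = underES (LBang-s!-reduct (ren-LBang (liftR suc) q) r) a

[0:=]-ren-suc : ∀ {n} (w u : Tm n) → ren suc u [0:= w ] ≡ u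
[0:=]-ren-suc w u = trans (sub-ren (single w) suc u) (sub-id (λ _ → refl) u)

s!-reduct-dB-reduct : ∀ {n} {Y : Tm (suc n)} {s : Tm n} (p : LLam Y) (r : LBang s) (u : Tm n) →
                      s!-reduct (dB-reduct p (ren suc u)) r ≡ dB-reduct (LLam-s!-reduct p r) u
s!-reduct-dB-reduct p (atBang w) u =
  trans (sub-dB-reduct (single w) p (ren suc u)) (cong (dB-reduct (sub-LLam (single w) p)) ([0:=]-ren-suc w u))
s!-reduct-dB-reduct p (underES r a) u = cong (λ z → es z a) (begin
  s!-reduct (ren (liftR suc) (dB-reduct p (ren suc u))) r   ≡⟨ cong (λ z → s!-reduct z r) (ren-dB-reduct (liftR suc) p (ren suc u)) ⟩
  s!-reduct (dB-reduct p' (ren (liftR suc) (ren suc u))) r  ≡⟨ cong (λ z → s!-reduct (dB-reduct p' z) r) (ren-suc-liftR suc u) ⟩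
  s!-reduct (dB-reduct p' (ren suc (ren suc u))) r          ≡⟨ s!-reduct-dB-reduct p' r (ren suc u) ⟩
  dB-reduct (LLam-s!-reduct p' r) (ren suc u)               ∎)
  where
  open ≡-Reasoning
  p' = ren-LLam (liftR suc) p

s!-reduct-d!-reduct : ∀ {n} {Y : Tm (suc n)} {s : Tm n} (q : LBang Y) (r : LBang s) →
                      s!-reduct (d!-reduct q) r ≡ d!-reduct (LBang-s!-reduct q r)
s!-reduct-d!-reduct q (atBang w)    = sub-d!-reduct (single w) q
s!-reduct-d!-reduct q (underES r a) = cong (λ z → es z a)
  (trans (cong (λ z → s!-reduct z r) (ren-d!-reduct (liftR suc) q)) (s!-reduct-d!-reduct (ren-LBang (liftR suc) q) r))

s!-reduct-s!-reduct : ∀ {n} (t : Tm (suc n)) {Y : Tm (suc n)} {s : Tm n} (q : LBang Y) (r : LBang s) →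
                      s!-reduct (s!-reduct (ren (liftR suc) t) q) r ≡ s!-reduct t (LBang-s!-reduct q r)
s!-reduct-s!-reduct t q (atBang w) =
  trans (sub-s!-reduct (single w) (ren (liftR suc) t) q) (cong (λ z → s!-reduct z (sub-LBang (single w) q))
    (trans (sub-ren (liftS (single w)) (liftR suc) t) (sub-id e t)))
  where
  e : liftS (single w) ∘ liftR suc ≗ var
  e zero    = refl
  e (suc i) = refl
s!-reduct-s!-reduct t q (underES r a) = cong (λ z → es z a) (begin
  s!-reduct (ren (liftR suc) (s!-reduct t₁ q)) r   ≡⟨ cong (λ z → s!-reduct z r) (ren-s!-reduct (liftR suc) t₁ q) ⟩
  s!-reduct (s!-reduct (ren (liftR (liftR suc)) t₁) q') r
    ≡⟨ cong (λ z → s!-reduct (s!-reduct z q') r) (begin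
         ren (liftR (liftR suc)) (ren (liftR suc) t) ≡⟨ ren-ren _ _ t ⟩
         ren (liftR (liftR suc) ∘ liftR suc) t       ≡⟨ ren-ext (liftR-liftR-suc suc) t ⟩
         ren (liftR suc ∘ liftR suc) t               ≡⟨ ren-ren _ _ t ⟨
         ren (liftR suc) t₁                          ∎) ⟩
  s!-reduct (s!-reduct (ren (liftR suc) t₁) q') r  ≡⟨ s!-reduct-s!-reduct t₁ q' r ⟩
  s!-reduct t₁ (LBang-s!-reduct q' r)              ∎)
  where
  open ≡-Reasoning
  t₁ = ren (liftR suc) t
  q' = ren-LBang (liftR suc) q

LLam-⇒ : ∀ {n} {X X' : Tm n} (p : LLam X) → X ⇒ X' → Σ (LLam X') λ p' → ∀ u → dB-reduct p u ⇒ dB-reduct p' u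
LLam-⇒ (atLam t)     (lamC r)        = atLam _ , λ u → esLC u r
LLam-⇒ (underES p s) (s! _ q)        = LLam-s!-reduct p q , λ u → subst (_ ⇒_) (s!-reduct-dB-reduct p q u) (s! _ q)
LLam-⇒ (underES p s) (esLC .s r) with LLam-⇒ p r
... | p' , f = underES p' s , λ u → esLC s (f (ren suc u))
LLam-⇒ (underES p s) (esRC _ r)      = underES p _ , λ u → esRC _ r

LBang-⇒ : ∀ {n} {X X' : Tm n} (q : LBang X) → X ⇒ X' →
          Σ (LBang X') λ q' → (∀ t → s!-reduct t q ⇒ s!-reduct t q') × d!-reduct q ⇒ d!-reduct q'
LBang-⇒ (underES q s) (s! _ r) =
  LBang-s!-reduct q r ,
  (λ t → subst (_ ⇒_) (s!-reduct-s!-reduct t q r) (s! _ r)) ,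
  subst (_ ⇒_) (s!-reduct-d!-reduct q r) (s! _ r)
LBang-⇒ (underES q s) (esLC .s r) with LBang-⇒ q r
... | q' , f , g = underES q' s , (λ t → esLC s (f (ren (liftR suc) t))) , esLC s g
LBang-⇒ (underES q s) (esRC _ r) = underES q _ , (λ t → esRC _ r) , esRC _ r

s!-reduct-⇒ : ∀ {n} {t t' : Tm (suc n)} {X : Tm n} (q : LBang X) → t ⇒ t' → s!-reduct t q ⇒ s!-reduct t' q
s!-reduct-⇒ (atBang u)    r = ⇒-sub (single u) r
s!-reduct-⇒ (underES q s) r = esLC s (s!-reduct-⇒ q (⇒-ren (liftR suc) r))

dB-reduct-⇒ : ∀ {n} {X : Tm n} {u u' : Tm n} (p : LLam X) → u ⇒ u' → dB-reduct p u ⇒ dB-reduct p u'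
dB-reduct-⇒ (atLam t)     r = esRC t r
dB-reduct-⇒ (underES p s) r = esLC s (dB-reduct-⇒ p (⇒-ren suc r))

Joinable : ∀ {n} → Tm n → Tm n → Set
Joinable a b = a ≡ b ⊎ ∃ λ c → a ⇒ c × b ⇒ c

Joinable-sym : ∀ {n} {a b : Tm n} → Joinable a b → Joinable b a
Joinable-sym (inj₁ e)           = inj₁ (sym e)
Joinable-sym (inj₂ (c , x , y)) = inj₂ (c , y , x)

Joinable-map : ∀ {n m} (f : Tm n → Tm m) → f Preserves _⇒_ ⟶ _⇒_ → ∀ {a b} → Joinable a b → Joinable (f a) (f b)
Joinable-map f g (inj₁ e)           = inj₁ (cong f e)
Joinable-map f g (inj₂ (c , x , y)) = inj₂ (f c , g x , g y)

⇒-diamond : ∀ {n} {t a b : Tm n} → t ⇒ a → t ⇒ b → Joinable a b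
⇒-diamond (dB p u) (dB p' .u) = inj₁ (cong (λ z → dB-reduct z u) (LLam-unique p p'))
⇒-diamond (dB p u) (appL .u r) with LLam-⇒ p r
... | p' , f = inj₂ (_ , f u , dB p' u)
⇒-diamond (dB p u) (appR _ r) = inj₂ (_ , dB-reduct-⇒ p r , dB p _)
⇒-diamond (s! t q) (s! .t q') = inj₁ (cong (s!-reduct t) (LBang-unique q q'))
⇒-diamond (s! t q) (esLC _ r) = inj₂ (_ , s!-reduct-⇒ q r , s! _ q)
⇒-diamond (s! t q) (esRC .t r) with LBang-⇒ q r
... | q' , f , _ = inj₂ (_ , f t , s! t q')
⇒-diamond (d! q) (d! q')      = inj₁ (cong d!-reduct (LBang-unique q q'))
⇒-diamond (d! q) (derC r) with LBang-⇒ q r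
... | q' , _ , g = inj₂ (_ , g , d! q')
⇒-diamond r@(appL _ _) r'@(dB _ _) = Joinable-sym (⇒-diamond r' r)
⇒-diamond r@(appR _ _) r'@(dB _ _) = Joinable-sym (⇒-diamond r' r)
⇒-diamond r@(esLC _ _) r'@(s! _ _) = Joinable-sym (⇒-diamond r' r)
⇒-diamond r@(esRC _ _) r'@(s! _ _) = Joinable-sym (⇒-diamond r' r)
⇒-diamond r@(derC _)   r'@(d! _)   = Joinable-sym (⇒-diamond r' r)
⇒-diamond (appL s r) (appL .s r') = Joinable-map (λ z → app z s) (appL s) (⇒-diamond r r')
⇒-diamond (appL s r) (appR _ r')  = inj₂ (_ , appR _ r' , appL _ r)
⇒-diamond (appR s r) (appL _ r')  = inj₂ (_ , appL _ r' , appR _ r)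
⇒-diamond (appR s r) (appR .s r') = Joinable-map (app s) (appR s) (⇒-diamond r r')
⇒-diamond (lamC r)   (lamC r')    = Joinable-map lam lamC (⇒-diamond r r')
⇒-diamond (derC r)   (derC r')    = Joinable-map der derC (⇒-diamond r r')
⇒-diamond (esLC s r) (esLC .s r') = Joinable-map (λ z → es z s) (esLC s) (⇒-diamond r r')
⇒-diamond (esLC s r) (esRC _ r')  = inj₂ (_ , esRC _ r' , esLC _ r)
⇒-diamond (esRC s r) (esLC _ r')  = inj₂ (_ , esLC _ r' , esRC _ r)
⇒-diamond (esRC s r) (esRC .s r') = Joinable-map (es s) (esRC s) (⇒-diamond r r')

→S*-to-⇒* : ∀ {n} {a b : Tm n} → a →S* b → a ⇒* b
→S*-to-⇒* = gmap id →S-to-⇒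

⇒*-to-→S* : ∀ {n} {a b : Tm n} → a ⇒* b → a →S* b
⇒*-to-→S* = gmap id ⇒-to-→S

SN : ∀ {n} → Tm n → Set
SN = Acc (flip _⇒_)

Normal : ∀ {n} → Tm n → Set
Normal t = ∀ {t'} → ¬ (t ⇒ t')

-- The diamond property makes SN closed under expansion.
SN-expand : ∀ {n} {t a : Tm n} → t ⇒ a → SN a → SN t
SN-expand {a = a} r (acc h) = acc λ r' → SN-joinable (⇒-diamond r r')
  where
  SN-joinable : ∀ {b} → Joinable a b → SN b
  SN-joinable (inj₁ refl)              = acc h
  SN-joinable (inj₂ (_ , a⇒c , b⇒c)) = SN-expand b⇒c (h a⇒c)

Normal-SN : ∀ {n} {t : Tm n} → Normal t → SN t
Normal-SN nf = acc λ r → ⊥-elim (nf r)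

WN-SN : ∀ {n} {t nf : Tm n} → Normal nf → t ⇒* nf → SN t
WN-SN nf ε        = Normal-SN nf
WN-SN nf (r ◅ rs) = SN-expand r (WN-SN nf rs)

bang-Normal : ∀ {n} (u : Tm n) → Normal (bang u)
bang-Normal u ()

SN-unplug : ∀ {n m} (f : Tm n → Tm m) → f Preserves _⇒_ ⟶ _⇒_ → ∀ {a} → SN (f a) → SN a
SN-unplug f f-mono (acc h) = acc λ r → SN-unplug f f-mono (h (f-mono r))

isLValue : ∀ {n} → TmV n → Bool
isLValue (var x)   = true
isLValue (lam t)   = true
isLValue (app t u) = false
isLValue (es t u)  = isLValue t

embedHeadES : ∀ {n} → Bool → Tm (suc n) → Tm (suc n) → Tm n → Tm n
embedHeadES true  h e u = es h u
embedHeadES false h e u = der (es e u)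

-- A structurally recursive presentation of _ᵛ: embedHead t is what (t u)ᵛ puts in function
-- position, namely L⟨s⟩ when tᵛ = L⟨!s⟩ (exactly when t = L⟨v⟩), and der(tᵛ) otherwise.
embed     : ∀ {n} → TmV n → Tm n
embedHead : ∀ {n} → TmV n → Tm n
embed (var x)       = bang (var x)
embed (lam t)       = bang (lam (embed t))
embed (app t u)     = app (embedHead t) (embed u)
embed (es t u)      = es (embed t) (embed u)
embedHead (var x)   = var x
embedHead (lam t)   = lam (embed t)
embedHead (app t u) = der (app (embedHead t) (embed u))
embedHead (es t u)  = embedHeadES (isLValue t) (embedHead t) (embed t) (embed u)

embedHead-es-LValue : ∀ {n} (t : TmV (suc n)) (u : TmV n) → isLValue t ≡ true →
                      embedHead (es t u) ≡ es (embedHead t) (embed u)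
embedHead-es-LValue t u e rewrite e = refl

embedHead-nonLValue : ∀ {n} (t : TmV n) → isLValue t ≡ false → embedHead t ≡ der (embed t)
embedHead-nonLValue (app t u) e = refl
embedHead-nonLValue (es t u)  e rewrite e = refl

embed-LValue-LBang : ∀ {n} (t : TmV n) → isLValue t ≡ true → Σ (LBang (embed t)) λ q → d!-reduct q ≡ embedHead t
embed-LValue-LBang (var x)  e = atBang (var x) , refl
embed-LValue-LBang (lam t)  e = atBang _ , refl
embed-LValue-LBang (es t u) e with embed-LValue-LBang t e
... | q , d = underES q (embed u) , trans (cong (λ z → es z (embed u)) d) (sym (embedHead-es-LValue t u e))

splitBang-LBang : ∀ {n} {X : Tm n} (q : LBang X) →
                  ∃ λ m → Σ (LCtx n m) λ L → Σ (Tm m) λ s → splitBang X ≡ just (m , L , s) × plugL L s ≡ d!-reduct q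
splitBang-LBang (atBang u) = _ , hole , u , refl , refl
splitBang-LBang (underES q s) with splitBang-LBang q
... | m , L , u , e , d rewrite e = m , esL L s , u , refl , cong (λ z → es z s) d

embApp-LBang : ∀ {n} {X : Tm n} (q : LBang X) (b : Tm n) → embApp X b ≡ app (d!-reduct q) b
embApp-LBang q b with splitBang-LBang q
... | _ , L , s , e , d rewrite e = cong (λ z → app z b) d

splitBang-embed-nonLValue : ∀ {n} (t : TmV n) → isLValue t ≡ false → splitBang (embed t) ≡ nothing
splitBang-embed-nonLValue (app t u) e = refl
splitBang-embed-nonLValue (es t u)  e rewrite splitBang-embed-nonLValue t e = refl

embApp-embed : ∀ {n} (t : TmV n) (b : Tm n) → embApp (embed t) b ≡ app (embedHead t) b
embApp-embed t b with isLValue t in e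
... | true with embed-LValue-LBang t e
...   | q , d = trans (embApp-LBang q b) (cong (λ z → app z b) d)
embApp-embed t b | false rewrite splitBang-embed-nonLValue t e | embedHead-nonLValue t e = refl

embed≡ᵛ : ∀ {n} (t : TmV n) → embed t ≡ t ᵛ
embed≡ᵛ (var x)   = refl
embed≡ᵛ (lam t)   = cong (λ z → bang (lam z)) (embed≡ᵛ t)
embed≡ᵛ (app t u) = begin
  app (embedHead t) (embed u) ≡⟨ embApp-embed t (embed u) ⟨
  embApp (embed t) (embed u)  ≡⟨ cong₂ embApp (embed≡ᵛ t) (embed≡ᵛ u) ⟩
  embApp (t ᵛ) (u ᵛ)          ∎
  where open ≡-Reasoning
embed≡ᵛ (es t u)  = cong₂ es (embed≡ᵛ t) (embed≡ᵛ u)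

isLValue-renV : ∀ {n m} (ρ : Ren n m) (t : TmV n) → isLValue (renV ρ t) ≡ isLValue t
isLValue-renV ρ (var x)   = refl
isLValue-renV ρ (lam t)   = refl
isLValue-renV ρ (app t u) = refl
isLValue-renV ρ (es t u)  = isLValue-renV (liftR ρ) t

ren-embedHeadES : ∀ {n m} (ρ : Ren n m) b h e u →
                  ren ρ (embedHeadES b h e u) ≡ embedHeadES b (ren (liftR ρ) h) (ren (liftR ρ) e) (ren ρ u)
ren-embedHeadES ρ true  h e u = refl
ren-embedHeadES ρ false h e u = refl

embed-renV     : ∀ {n m} (ρ : Ren n m) (t : TmV n) → embed (renV ρ t) ≡ ren ρ (embed t)
embedHead-renV : ∀ {n m} (ρ : Ren n m) (t : TmV n) → embedHead (renV ρ t) ≡ ren ρ (embedHead t)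
embed-renV ρ (var x)   = refl
embed-renV ρ (lam t)   = cong (λ z → bang (lam z)) (embed-renV (liftR ρ) t)
embed-renV ρ (app t u) = cong₂ app (embedHead-renV ρ t) (embed-renV ρ u)
embed-renV ρ (es t u)  = cong₂ es (embed-renV (liftR ρ) t) (embed-renV ρ u)
embedHead-renV ρ (var x)   = refl
embedHead-renV ρ (lam t)   = cong lam (embed-renV (liftR ρ) t)
embedHead-renV ρ (app t u) = cong der (cong₂ app (embedHead-renV ρ t) (embed-renV ρ u))
embedHead-renV ρ (es t u)
  rewrite isLValue-renV (liftR ρ) t | embedHead-renV (liftR ρ) t | embed-renV (liftR ρ) t | embed-renV ρ u =
  sym (ren-embedHeadES ρ (isLValue t) (embedHead t) (embed t) (embed u))

ren-ᵛ : ∀ {n k} (ρ : Ren n k) (t : TmV n) → ren ρ (t ᵛ) ≡ embed (renV ρ t)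
ren-ᵛ ρ t = trans (cong (ren ρ) (sym (embed≡ᵛ t))) (sym (embed-renV ρ t))

IsValueSub : ∀ {n m} → SubV n m → Set
IsValueSub σ = ∀ i → IsValue (σ i)

IsValue-renV : ∀ {n m} (ρ : Ren n m) {v : TmV n} → IsValue v → IsValue (renV ρ v)
IsValue-renV ρ (var i) = var (ρ i)
IsValue-renV ρ (lam t) = lam _

IsValueSub-liftSV : ∀ {n m} {σ : SubV n m} → IsValueSub σ → IsValueSub (liftSV σ)
IsValueSub-liftSV vs zero    = var zero
IsValueSub-liftSV vs (suc i) = IsValue-renV suc (vs i)

IsValueSub-singleV : ∀ {n} {v : TmV n} → IsValue v → IsValueSub (singleV v)
IsValueSub-singleV iv zero    = iv
IsValueSub-singleV iv (suc i) = var i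

IsValue-isLValue : ∀ {n} {v : TmV n} → IsValue v → isLValue v ≡ true
IsValue-isLValue (var i) = refl
IsValue-isLValue (lam t) = refl

embed-IsValue : ∀ {n} {v : TmV n} → IsValue v → embed v ≡ bang (embedHead v)
embed-IsValue (var i) = refl
embed-IsValue (lam t) = refl

isLValue-subV : ∀ {n m} {σ : SubV n m} → IsValueSub σ → (t : TmV n) → isLValue (subV σ t) ≡ isLValue t
isLValue-subV vs (var x)   = IsValue-isLValue (vs x)
isLValue-subV vs (lam t)   = refl
isLValue-subV vs (app t u) = refl
isLValue-subV vs (es t u)  = isLValue-subV (IsValueSub-liftSV vs) t

sub-embedHeadES : ∀ {n m} (σ : Sub n m) b h e u →
                  sub σ (embedHeadES b h e u) ≡ embedHeadES b (sub (liftS σ) h) (sub (liftS σ) e) (sub σ u)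
sub-embedHeadES σ true  h e u = refl
sub-embedHeadES σ false h e u = refl

liftS-embedHead : ∀ {n m} (σ : SubV n m) (τ : Sub n m) → embedHead ∘ σ ≗ τ → embedHead ∘ liftSV σ ≗ liftS τ
liftS-embedHead σ τ e zero    = refl
liftS-embedHead σ τ e (suc i) = trans (embedHead-renV suc (σ i)) (cong (ren suc) (e i))

embed-subV     : ∀ {n m} {σ : SubV n m} → IsValueSub σ → (τ : Sub n m) → embedHead ∘ σ ≗ τ →
                 (t : TmV n) → embed (subV σ t) ≡ sub τ (embed t)
embedHead-subV : ∀ {n m} {σ : SubV n m} → IsValueSub σ → (τ : Sub n m) → embedHead ∘ σ ≗ τ →
                 (t : TmV n) → embedHead (subV σ t) ≡ sub τ (embedHead t)
embed-subV vs τ e (var x)   = trans (embed-IsValue (vs x)) (cong bang (e x))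
embed-subV vs τ e (lam t)   =
  cong (λ z → bang (lam z)) (embed-subV (IsValueSub-liftSV vs) (liftS τ) (liftS-embedHead _ τ e) t)
embed-subV vs τ e (app t u) = cong₂ app (embedHead-subV vs τ e t) (embed-subV vs τ e u)
embed-subV vs τ e (es t u)  =
  cong₂ es (embed-subV (IsValueSub-liftSV vs) (liftS τ) (liftS-embedHead _ τ e) t) (embed-subV vs τ e u)
embedHead-subV vs τ e (var x)   = e x
embedHead-subV vs τ e (lam t)   = cong lam (embed-subV (IsValueSub-liftSV vs) (liftS τ) (liftS-embedHead _ τ e) t)
embedHead-subV vs τ e (app t u) = cong der (cong₂ app (embedHead-subV vs τ e t) (embed-subV vs τ e u))
embedHead-subV {σ = σ} vs τ e (es t u)
  rewrite isLValue-subV (IsValueSub-liftSV vs) t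
        | embedHead-subV (IsValueSub-liftSV vs) (liftS τ) (liftS-embedHead σ τ e) t
        | embed-subV (IsValueSub-liftSV vs) (liftS τ) (liftS-embedHead σ τ e) t
        | embed-subV vs τ e u =
  sym (sub-embedHeadES τ (isLValue t) (embedHead t) (embed t) (embed u))

embed-renV-[0:=] : ∀ {n m} {v : TmV m} → IsValue v → (ρ : Ren (suc n) (suc m)) (t : TmV (suc n)) →
                   embed (subV (singleV v) (renV ρ t)) ≡ ren ρ (embed t) [0:= embedHead v ]
embed-renV-[0:=] {v = v} iv ρ t =
  trans (embed-subV (IsValueSub-singleV iv) (single (embedHead v)) (λ { zero → refl ; (suc i) → refl }) (renV ρ t))
        (cong (_[0:= embedHead v ]) (embed-renV ρ t))

embedHead-renV-[0:=] : ∀ {n m} {v : TmV m} → IsValue v → (ρ : Ren (suc n) (suc m)) (t : TmV (suc n)) →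
                       embedHead (subV (singleV v) (renV ρ t)) ≡ ren ρ (embedHead t) [0:= embedHead v ]
embedHead-renV-[0:=] {v = v} iv ρ t =
  trans (embedHead-subV (IsValueSub-singleV iv) (single (embedHead v)) (λ { zero → refl ; (suc i) → refl }) (renV ρ t))
        (cong (_[0:= embedHead v ]) (embedHead-renV ρ t))

embedL : ∀ {n m} → LCtxV n m → LCtx n m
embedL hole      = hole
embedL (esL L s) = esL (embedL L) (embed s)

wkL-embedL : ∀ {n m} (L : LCtxV n m) → wkL (embedL L) ≗ wkLV L
wkL-embedL hole      i = refl
wkL-embedL (esL L s) i = wkL-embedL L (suc i)

embed-plugLV : ∀ {n m} (L : LCtxV n m) (X : TmV m) → embed (plugLV L X) ≡ plugL (embedL L) (embed X)
embed-plugLV hole      X = refl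
embed-plugLV (esL L s) X = cong (λ z → es z (embed s)) (embed-plugLV L X)

isLValue-plugLV : ∀ {n m} (L : LCtxV n m) (X : TmV m) → isLValue (plugLV L X) ≡ isLValue X
isLValue-plugLV hole      X = refl
isLValue-plugLV (esL L s) X = isLValue-plugLV L X

embedHead-plugLV : ∀ {n m} (L : LCtxV n m) {X : TmV m} → isLValue X ≡ true →
                   embedHead (plugLV L X) ≡ plugL (embedL L) (embedHead X)
embedHead-plugLV hole      e = refl
embedHead-plugLV (esL L s) {X} e =
  trans (embedHead-es-LValue (plugLV L X) s (trans (isLValue-plugLV L X) e))
        (cong (λ z → es z (embed s)) (embedHead-plugLV L e))

der-embed-⇒*-embedHead : ∀ {n} (t : TmV n) → der (embed t) ⇒* embedHead t
der-embed-⇒*-embedHead t with isLValue t in e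
... | false = subst (der (embed t) ⇒*_) (sym (embedHead-nonLValue t e)) ε
... | true with embed-LValue-LBang t e
...   | q , d = subst (der (embed t) ⇒*_) d (d! q ◅ ε)

-- Simulation of λv in λ!

infix 4 _⇒⁺_
_⇒⁺_ : ∀ {n} → Tm n → Tm n → Set
a ⇒⁺ b = ∃ λ c → a ⇒ c × c ⇒* b

⇒⁺-map : ∀ {n m} (f : Tm n → Tm m) → f Preserves _⇒_ ⟶ _⇒_ → ∀ {a b} → a ⇒⁺ b → f a ⇒⁺ f b
⇒⁺-map f f-mono (c , r , rs) = f c , f-mono r , gmap f f-mono rs

⇒⁺-to-⇒* : ∀ {n} {a b : Tm n} → a ⇒⁺ b → a ⇒* b
⇒⁺-to-⇒* (_ , r , rs) = r ◅ rs

⇒-to-⇒⁺ : ∀ {n} {a b : Tm n} → a ⇒ b → a ⇒⁺ b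
⇒-to-⇒⁺ r = _ , r , ε

isLValue-→v : ∀ {n} {t t' : TmV n} → t →v t' → isLValue t ≡ true → isLValue t' ≡ true
isLValue-→v (root (sv L r v iv)) e = begin
  isLValue (plugLV L (subV (singleV v) (renV ρ r)))  ≡⟨ isLValue-plugLV L _ ⟩
  isLValue (subV (singleV v) (renV ρ r))             ≡⟨ isLValue-subV (IsValueSub-singleV iv) (renV ρ r) ⟩
  isLValue (renV ρ r)                                ≡⟨ isLValue-renV ρ r ⟩
  isLValue r                                         ≡⟨ e ⟩
  true                                               ∎
  where
  open ≡-Reasoning
  ρ = liftR (wkLV L)
isLValue-→v (esLC s r) e = isLValue-→v r e
isLValue-→v (esRC s r) e = e

embed-dB-step : ∀ {n m} (L : LCtxV n m) (r : TmV (suc m)) (u : TmV n) →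
                embed (app (plugLV L (lam r)) u) ⇒ embed (plugLV L (es r (renV (wkLV L) u)))
embed-dB-step L r u with plugL-LLam (embedL L) (embed r)
... | p , e = subst₂ _⇒_ (cong (λ z → app z (embed u)) (sym (embedHead-plugLV L refl))) (begin
  dB-reduct p (embed u)                                 ≡⟨ e (embed u) ⟩
  plugL L̂ (es (embed r) (ren (wkL L̂) (embed u)))       ≡⟨ cong (plugL L̂ ∘ es (embed r)) (ren-ext (wkL-embedL L) (embed u)) ⟩
  plugL L̂ (es (embed r) (ren (wkLV L) (embed u)))      ≡⟨ cong (plugL L̂ ∘ es (embed r)) (embed-renV (wkLV L) u) ⟨
  plugL L̂ (embed (es r (renV (wkLV L) u)))             ≡⟨ embed-plugLV L _ ⟨
  embed (plugLV L (es r (renV (wkLV L) u)))            ∎) (dB p (embed u))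
  where
  open ≡-Reasoning
  L̂ = embedL L

s!-embed-LValue : ∀ {n m} (L : LCtxV n m) {v : TmV m} → IsValue v → (h : Tm (suc n)) →
                  es h (embed (plugLV L v)) ⇒ plugL (embedL L) (ren (liftR (wkLV L)) h [0:= embedHead v ])
s!-embed-LValue L {v} iv h with plugL-LBang (embedL L) (embedHead v)
... | q , e , _ =
  subst₂ _⇒_ (cong (es h) (sym (trans (embed-plugLV L v) (cong (plugL (embedL L)) (embed-IsValue iv)))))
             (trans (e h) (cong (λ z → plugL (embedL L) (z [0:= embedHead v ])) (ren-ext (liftR-ext (wkL-embedL L)) h)))
             (s! h q)

embed-sv-step : ∀ {n m} (L : LCtxV n m) (r : TmV (suc n)) {v : TmV m} → IsValue v →
                embed (es r (plugLV L v)) ⇒ embed (plugLV L (subV (singleV v) (renV (liftR (wkLV L)) r)))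
embed-sv-step L r {v} iv =
  subst (es (embed r) (embed (plugLV L v)) ⇒_)
        (sym (trans (embed-plugLV L _) (cong (plugL (embedL L)) (embed-renV-[0:=] iv (liftR (wkLV L)) r))))
        (s!-embed-LValue L iv (embed r))

embedHead-sv-step : ∀ {n m} (L : LCtxV n m) (r : TmV (suc n)) {v : TmV m} → IsValue v → isLValue r ≡ true →
                    embedHead (es r (plugLV L v)) ⇒ embedHead (plugLV L (subV (singleV v) (renV (liftR (wkLV L)) r)))
embedHead-sv-step L r {v} iv e =
  subst₂ _⇒_ (sym (embedHead-es-LValue r _ e))
             (sym (trans (embedHead-plugLV L reduct-LValue) (cong (plugL (embedL L)) (embedHead-renV-[0:=] iv ρ r))))
             (s!-embed-LValue L iv (embedHead r))
  where
  ρ = liftR (wkLV L)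
  reduct-LValue : isLValue (subV (singleV v) (renV ρ r)) ≡ true
  reduct-LValue = trans (isLValue-subV (IsValueSub-singleV iv) (renV ρ r)) (trans (isLValue-renV ρ r) e)

embed-sim            : ∀ {n} {t t' : TmV n} → t →v t' → embed t ⇒⁺ embed t'
embedHead-sim        : ∀ {n} {t t' : TmV n} → t →v t' → embedHead t ⇒⁺ embedHead t'
embedHead-sim-LValue : ∀ {n} {t t' : TmV n} → isLValue t ≡ true → t →v t' → embedHead t ⇒⁺ embedHead t'

embed-sim (root (dB L r u))      = ⇒-to-⇒⁺ (embed-dB-step L r u)
embed-sim (root (sv L r v iv))   = ⇒-to-⇒⁺ (embed-sv-step L r iv)
embed-sim (appL s r)             = ⇒⁺-map (λ z → app z (embed s)) (appL _) (embedHead-sim r)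
embed-sim {t = app s _} (appR .s r) = ⇒⁺-map (app (embedHead s)) (appR _) (embed-sim r)
embed-sim (esLC s r)             = ⇒⁺-map (λ z → es z (embed s)) (esLC _) (embed-sim r)
embed-sim {t = es s _} (esRC .s r) = ⇒⁺-map (es (embed s)) (esRC _) (embed-sim r)

embedHead-sim {t = t} {t'} r with isLValue t in e
... | true  = embedHead-sim-LValue e r
... | false with embed-sim r
...   | c , r₁ , rs = subst (_⇒⁺ embedHead t') (sym (embedHead-nonLValue t e))
                        (der c , derC r₁ , gmap der derC rs ◅◅ der-embed-⇒*-embedHead t')

embedHead-sim-LValue e (root (sv L r v iv)) = ⇒-to-⇒⁺ (embedHead-sv-step L r iv e)
embedHead-sim-LValue {t = es r s} {es r' .s} e (esLC .s st) =
  subst₂ _⇒⁺_ (sym (embedHead-es-LValue r s e)) (sym (embedHead-es-LValue r' s (isLValue-→v st e)))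
    (⇒⁺-map (λ z → es z (embed s)) (esLC _) (embedHead-sim-LValue e st))
embedHead-sim-LValue {t = es r s} {es .r s'} e (esRC .r st) =
  subst₂ _⇒⁺_ (sym (embedHead-es-LValue r s e)) (sym (embedHead-es-LValue r s' e))
    (⇒⁺-map (es (embedHead r)) (esRC _) (embed-sim st))

embed-sim* : ∀ {n} {t t' : TmV n} → t →v* t' → embed t ⇒* embed t'
embed-sim* ε        = ε
embed-sim* (r ◅ rs) = ⇒⁺-to-⇒* (embed-sim r) ◅◅ embed-sim* rs

SNv : ∀ {n} → TmV n → Set
SNv = Acc (flip _→v_)

SN-SNv : ∀ {n} {a : Tm n} {t : TmV n} → SN a → a ⇒* embed t → SNv t
SN-SNv {t = t} (acc h) ε = acc step
  where
  step : ∀ {t'} → t →v t' → SNv t'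
  step st with embed-sim st
  ... | _ , r , rs = SN-SNv (h r) rs
SN-SNv (acc h) (r ◅ rs) = acc λ st → SN-SNv (h r) (rs ◅◅ ⇒⁺-to-⇒* (embed-sim st))

data NfKind : Set where
  kVar kAbs kApp : NfKind

data ValueKind : NfKind → Set where
  kVar : ValueKind kVar
  kAbs : ValueKind kAbs

data NonAbsKind : NfKind → Set where
  kVar : NonAbsKind kVar
  kApp : NonAbsKind kApp

-- Indexed by whether the hole of the list context holds a variable, an abstraction or an application.
data Nf {n : ℕ} : NfKind → TmV n → Set where
  nvar : (x : Fin n) → Nf kVar (var x)
  nlam : (t : TmV (suc n)) → Nf kAbs (lam t)
  napp : ∀ {k k' t u} → NonAbsKind k → Nf k t → Nf k' u → Nf kApp (app t u)
  nes  : ∀ {k t u} → Nf k t → Nf kApp u → Nf k (es t u)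

Nf-LValue : ∀ {n k} {t : TmV n} → Nf k t → ValueKind k →
            ∃ λ m → Σ (LCtxV n m) λ L → Σ (TmV m) λ v → IsValue v × t ≡ plugLV L v
Nf-LValue (nvar x) _ = _ , hole , var x , var x , refl
Nf-LValue (nlam t) _ = _ , hole , lam t , lam t , refl
Nf-LValue (nes {u = u} nt nu) vk with Nf-LValue nt vk
... | m , L , v , iv , refl = m , esL L u , v , iv , refl

Nf-LLam : ∀ {n} {t : TmV n} → Nf kAbs t → ∃ λ m → Σ (LCtxV n m) λ L → Σ (TmV (suc m)) λ r → t ≡ plugLV L (lam r)
Nf-LLam (nlam t) = _ , hole , t , refl
Nf-LLam (nes {u = u} nt nu) with Nf-LLam nt
... | m , L , r , refl = m , esL L u , r , refl

Progress : ∀ {n} → TmV n → Set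
Progress t = (∃ λ k → Nf k t) ⊎ (∃ λ t' → t →v t')

progress-app : ∀ {n} (t u : TmV n) → Progress t → Progress u → Progress (app t u)
progress-app t u (inj₂ (_ , st))     _                    = inj₂ (_ , appL u st)
progress-app t u (inj₁ (kAbs , nt))  _ with Nf-LLam nt
... | _ , L , r , refl = inj₂ (_ , root (dB L r u))
progress-app t u (inj₁ (kVar , nt))  (inj₂ (_ , st))      = inj₂ (_ , appR t st)
progress-app t u (inj₁ (kApp , nt))  (inj₂ (_ , st))      = inj₂ (_ , appR t st)
progress-app t u (inj₁ (kVar , nt))  (inj₁ (_ , nu))      = inj₁ (kApp , napp kVar nt nu)
progress-app t u (inj₁ (kApp , nt))  (inj₁ (_ , nu))      = inj₁ (kApp , napp kApp nt nu)

progress-es : ∀ {n} (t : TmV (suc n)) (u : TmV n) → Progress t → Progress u → Progress (es t u)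
progress-es t u _                (inj₂ (_ , st))     = inj₂ (_ , esRC t st)
progress-es t u _                (inj₁ (kVar , nu)) with Nf-LValue nu kVar
... | _ , L , v , iv , refl = inj₂ (_ , root (sv L t v iv))
progress-es t u _                (inj₁ (kAbs , nu)) with Nf-LValue nu kAbs
... | _ , L , v , iv , refl = inj₂ (_ , root (sv L t v iv))
progress-es t u (inj₂ (_ , st))  (inj₁ (kApp , nu))  = inj₂ (_ , esLC u st)
progress-es t u (inj₁ (k , nt))  (inj₁ (kApp , nu))  = inj₁ (k , nes nt nu)

progress : ∀ {n} (t : TmV n) → Progress t
progress (var x)   = inj₁ (kVar , nvar x)
progress (lam t)   = inj₁ (kAbs , nlam t)
progress (app t u) = progress-app t u (progress t) (progress u)
progress (es t u)  = progress-es t u (progress t) (progress u)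

SNv-normalise : ∀ {n} {t : TmV n} → SNv t → ∃ λ k → Σ (TmV n) λ nf → t →v* nf × Nf k nf
SNv-normalise {t = t} (acc h) with progress t
... | inj₁ (k , nt) = k , t , ε , nt
... | inj₂ (_ , st) with SNv-normalise (h st)
...   | k , nf , rs , nnf = k , nf , st ◅ rs , nnf

-- Meaningful terms are surface normalising

embedT : ∀ {n m} → TCtxV n m → Tm m → Tm n
embedT hole       X = X
embedT (appT T a) X = app (der (embedT T X)) (embed a)
embedT (redT T a) X = app (lam (embedT T X)) (embed a)

embedT-⇒ : ∀ {n m} (T : TCtxV n m) → embedT T Preserves _⇒_ ⟶ _⇒_
embedT-⇒ hole       r = r
embedT-⇒ (appT T s) r = appL _ (derC (embedT-⇒ T r))
embedT-⇒ (redT T s) r = appL _ (lamC (embedT-⇒ T r))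

embedT-embed : ∀ {n m} (T : TCtxV n m) (s : TmV m) → embedT T (embed s) ⇒* embed (plugTV T s)
embedT-embed hole       s = ε
embedT-embed (appT T a) s =
  gmap (λ z → app (der z) (embed a)) (λ r → appL _ (derC r)) (embedT-embed T s)
  ◅◅ gmap (λ z → app z (embed a)) (appL _) (der-embed-⇒*-embedHead (plugTV T s))
embedT-embed (redT T a) s = gmap (λ z → app (lam z) (embed a)) (λ r → appL _ (lamC r)) (embedT-embed T s)

MeaningfulV-SNv : ∀ {m k} (T : TCtxV m k) (X : TmV k) {v : TmV m} → IsValue v → plugTV T X →v* v → SNv X
MeaningfulV-SNv T X iv rs =
  SN-SNv (SN-unplug (embedT T) (embedT-⇒ T) (WN-SN (bang-Normal _) embedT-X⇒*bang)) ε
  where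
  embedT-X⇒*bang : embedT T (embed X) ⇒* bang _
  embedT-X⇒*bang = embedT-embed T X ◅◅ subst (embed (plugTV T X) ⇒*_) (embed-IsValue iv) (embed-sim* rs)

plugT-⇒ : ∀ {n m} (T : TCtx n m) → plugT T Preserves _⇒_ ⟶ _⇒_
plugT-⇒ hole       r = r
plugT-⇒ (appT T s) r = appL s (plugT-⇒ T r)
plugT-⇒ (redT T s) r = appL s (lamC (plugT-⇒ T r))

Meaningful!-SNv : ∀ {m k} (T : TCtx m k) (X : TmV k) {u : Tm m} → plugT T (embed X) ⇒* bang u → SNv X
Meaningful!-SNv T X rs = SN-SNv (SN-unplug (plugT T) (plugT-⇒ T) (WN-SN (bang-Normal _) rs)) ε

-- Surface normal forms are meaningful

-- eater w →v* eater for every value w, so binding the free variables of a normal form to eater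
-- unblocks every application they head.
eater₀ : ∀ {n} → TmV n
eater₀ = lam (lam (app (var (suc zero)) (var (suc zero))))

eater : ∀ {n} → TmV n
eater = lam (app eater₀ eater₀)

eater₀-eater₀ : ∀ {n} → app (eater₀ {n}) eater₀ →v* eater
eater₀-eater₀ = root (dB hole _ eater₀) ◅ root (sv hole _ eater₀ (lam _)) ◅ ε

eater-IsValue : ∀ {n} {w : TmV n} → IsValue w → app eater w →v* eater
eater-IsValue {w = w} iv =
  root (dB hole _ w) ◅ root (sv hole (app eater₀ eater₀) (renV id w) (IsValue-renV id iv)) ◅ eater₀-eater₀

closeV : ∀ {n m} → SubV n m
closeV _ = eater

es-eater-closeV : ∀ {n m} (X : TmV (suc n)) → es (subV (liftSV (closeV {n} {m})) X) eater →v subV closeV X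
es-eater-closeV X =
  subst (es (subV (liftSV closeV) X) eater →v_) fuse (root (sv hole (subV (liftSV closeV) X) eater (lam _)))
  where
  fuse : subV (singleV eater) (renV (liftR id) (subV (liftSV closeV) X)) ≡ subV closeV X
  fuse = trans (cong (subV (singleV eater)) (renV-id liftR-id (subV (liftSV closeV) X)))
               (trans (subV-subV (singleV eater) (liftSV closeV) X) (subV-ext (λ { zero → refl ; (suc i) → refl }) X))

Nf-closeV-value : ∀ {n m k} {t : TmV n} → Nf k t → ∃ λ v → IsValue v × subV (closeV {n} {m}) t →v* v
Nf-closeV-eater : ∀ {n m k} {t : TmV n} → Nf k t → NonAbsKind k → subV (closeV {n} {m}) t →v* eater

Nf-closeV-value (nlam t)           = _ , lam _ , ε
Nf-closeV-value nt@(nvar x)        = eater , lam _ , Nf-closeV-eater nt kVar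
Nf-closeV-value nt@(napp _ _ _)    = eater , lam _ , Nf-closeV-eater nt kApp
Nf-closeV-value {m = m} (nes {t = t} nt nu) with Nf-closeV-value {m = m} nt
... | v , iv , rs = v , iv , gmap (es _) (esRC _) (Nf-closeV-eater nu kApp) ◅◅ es-eater-closeV t ◅ rs

Nf-closeV-eater (nvar x) _ = ε
Nf-closeV-eater {m = m} (napp {u = u} k nt nu) _ with Nf-closeV-value {m = m} nu
... | w , iw , rs = gmap (λ z → app z (subV closeV u)) (appL _) (Nf-closeV-eater nt k)
                    ◅◅ gmap (app eater) (appR eater) rs ◅◅ eater-IsValue iw
Nf-closeV-eater (nes {t = t} nt nu) k =
  gmap (es _) (esRC _) (Nf-closeV-eater nu kApp) ◅◅ es-eater-closeV t ◅ Nf-closeV-eater nt k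

snocTV : ∀ {n m} → TCtxV n m → TmV m → TCtxV n (suc m)
snocTV hole       s = redT hole s
snocTV (appT T a) s = appT (snocTV T s) a
snocTV (redT T a) s = redT (snocTV T s) a

plugTV-snocTV : ∀ {n m} (T : TCtxV n m) (s : TmV m) (X : TmV (suc m)) → plugTV (snocTV T s) X ≡ plugTV T (app (lam X) s)
plugTV-snocTV hole       s X = refl
plugTV-snocTV (appT T a) s X = cong (λ z → app z a) (plugTV-snocTV T s X)
plugTV-snocTV (redT T a) s X = cong (λ z → app (lam z) a) (plugTV-snocTV T s X)

snocLV : ∀ {n m} → LCtxV n m → TmV m → LCtxV n (suc m)
snocLV hole      s = esL hole s
snocLV (esL L a) s = esL (snocLV L s) a

plugLV-snocLV : ∀ {n m} (L : LCtxV n m) (s : TmV m) (X : TmV (suc m)) → plugLV (snocLV L s) X ≡ plugLV L (es X s)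
plugLV-snocLV hole      s X = refl
plugLV-snocLV (esL L a) s X = cong (λ z → es z a) (plugLV-snocLV L s X)

plugLV-→v : ∀ {n m} (L : LCtxV n m) → plugLV L Preserves _→v_ ⟶ _→v_
plugLV-→v hole      st = st
plugLV-→v (esL L s) st = esLC s (plugLV-→v L st)

-- (λx₁. … (λxₖ. □) eater …) eater  and  □[xₖ\eater]…[x₁\eater]
eaterCtxV : ∀ k → TCtxV 0 k
eaterCtxV zero    = hole
eaterCtxV (suc k) = snocTV (eaterCtxV k) eater

eaterEnv : ∀ k → LCtxV 0 k
eaterEnv zero    = hole
eaterEnv (suc k) = snocLV (eaterEnv k) eater

eaterCtxV-eaterEnv : ∀ k (X : TmV k) → plugTV (eaterCtxV k) X →v* plugLV (eaterEnv k) X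
eaterCtxV-eaterEnv zero    X = ε
eaterCtxV-eaterEnv (suc k) X =
  subst₂ _→v*_ (sym (plugTV-snocTV (eaterCtxV k) eater X)) (sym (plugLV-snocLV (eaterEnv k) eater X))
    (eaterCtxV-eaterEnv k (app (lam X) eater) ◅◅ plugLV-→v (eaterEnv k) (root (dB hole X eater)) ◅ ε)

eaterEnv-closeV : ∀ k (X : TmV k) → plugLV (eaterEnv k) X →v* subV closeV X
eaterEnv-closeV zero    X = subst (X →v*_) (sym (subV-id (λ ()) X)) ε
eaterEnv-closeV (suc k) X =
  subst (_→v* subV closeV X) (sym (plugLV-snocLV (eaterEnv k) eater X))
    (eaterEnv-closeV k (es X eater) ◅◅ es-eater-closeV X ◅ ε)

SNv-MeaningfulV : ∀ {k} {X : TmV k} → SNv X → ∃ λ v → IsValue v × plugTV (eaterCtxV k) X →v* v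
SNv-MeaningfulV {k} {X} sn with SNv-normalise sn
... | _ , nf , rs , nnf with Nf-closeV-value {m = 0} nnf
...   | v , iv , rs' = v , iv ,
  (eaterCtxV-eaterEnv k X ◅◅ gmap (plugLV (eaterEnv k)) (plugLV-→v (eaterEnv k)) rs ◅◅ eaterEnv-closeV k nf ◅◅ rs')

snocT : ∀ {n m} → TCtx n m → Tm m → TCtx n (suc m)
snocT hole       s = redT hole s
snocT (appT T a) s = appT (snocT T s) a
snocT (redT T a) s = redT (snocT T s) a

plugT-snocT : ∀ {n m} (T : TCtx n m) (s : Tm m) (X : Tm (suc m)) → plugT (snocT T s) X ≡ plugT T (app (lam X) s)
plugT-snocT hole       s X = refl
plugT-snocT (appT T a) s X = cong (λ z → app z a) (plugT-snocT T s X)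
plugT-snocT (redT T a) s X = cong (λ z → app (lam z) a) (plugT-snocT T s X)

embedT-snocTV : ∀ {n m} (T : TCtxV n m) (s : TmV m) (X : Tm (suc m)) →
                embedT (snocTV T s) X ≡ embedT T (app (lam X) (embed s))
embedT-snocTV hole       s X = refl
embedT-snocTV (appT T a) s X = cong (λ z → app (der z) (embed a)) (embedT-snocTV T s X)
embedT-snocTV (redT T a) s X = cong (λ z → app (lam z) (embed a)) (embedT-snocTV T s X)

eaterCtx! : ∀ k → TCtx 0 k
eaterCtx! zero    = hole
eaterCtx! (suc k) = snocT (eaterCtx! k) (embed eater)

embedT-eaterCtxV : ∀ k (X : Tm k) → embedT (eaterCtxV k) X ≡ plugT (eaterCtx! k) X
embedT-eaterCtxV zero    X = refl
embedT-eaterCtxV (suc k) X = begin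
  embedT (snocTV (eaterCtxV k) eater) X              ≡⟨ embedT-snocTV (eaterCtxV k) eater X ⟩
  embedT (eaterCtxV k) (app (lam X) (embed eater))   ≡⟨ embedT-eaterCtxV k (app (lam X) (embed eater)) ⟩
  plugT (eaterCtx! k) (app (lam X) (embed eater))    ≡⟨ plugT-snocT (eaterCtx! k) (embed eater) X ⟨
  plugT (snocT (eaterCtx! k) (embed eater)) X        ∎
  where open ≡-Reasoning

SNv-Meaningful! : ∀ {k} {X : TmV k} → SNv X → ∃ λ u → plugT (eaterCtx! k) (embed X) ⇒* bang u
SNv-Meaningful! {k} {X} sn with SNv-MeaningfulV sn
... | v , iv , rs = embedHead v ,
  subst₂ _⇒*_ (embedT-eaterCtxV k (embed X)) (embed-IsValue iv)
    (embedT-embed (eaterCtxV k) X ◅◅ embed-sim* rs)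

theorem5p14 : ∀ {n : ℕ} (t : TmV n) → (MeaningfulV t → Meaningful! (t ᵛ)) × (Meaningful! (t ᵛ) → MeaningfulV t)
theorem5p14 t = forward , backward
  where
  forward : MeaningfulV t → Meaningful! (t ᵛ)
  forward (_ , k , T , ρ , ρ-inj , _ , iv , rs)
    with SNv-Meaningful! (MeaningfulV-SNv T (renV ρ t) iv rs)
  ... | u , rs! = 0 , k , eaterCtx! k , ρ , ρ-inj , u ,
    ⇒*-to-→S* (subst (λ X → plugT (eaterCtx! k) X ⇒* bang u) (sym (ren-ᵛ ρ t)) rs!)

  backward : Meaningful! (t ᵛ) → MeaningfulV t
  backward (_ , k , T , ρ , ρ-inj , u , rs)
    with SNv-MeaningfulV (Meaningful!-SNv T (renV ρ t)
           (subst (λ X → plugT T X ⇒* bang u) (ren-ᵛ ρ t) (→S*-to-⇒* rs)))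
  ... | v , iv , rsv = 0 , k , eaterCtxV k , ρ , ρ-inj , v , iv , rsv
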